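{- Let $p$ be a prime, let $m>n\geqslant1$ and $i\geqslant0$ be integers, and let $j\geqslant1$ be an integer not divisible by $p$. Suppose that $t=s_p(n,i,j)$ satisfies $$\frac{m-n}{mn}\cdot\frac{p^t-1}{p-1}\cdot j\geqslant 2t.$$ Then $$\sum_{0\leqslant h<i}\big(s_p(m,h,j)-s_p(n,h,j)\big)\geqslant s_p(n,i,j),$$ i.e. $v_p(\alpha_p(m,n,i,j))\geqslant s_p(n,i,j)$.
   Context: $s_p(m,i,j)=\operatorname{card}(\{1,2,\dots,m(i+1)\}\cap\{j,pj,p^2j,\dots\})$. $\alpha_p(m,n,i,j)$ denotes a $p$-adic integer with $v_p(\alpha_p(m,n,i,j))=\sum_{0\leqslant h<i}(s_p(m,h,j)-s_p(n,h,j))$. -}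

module Defs where

open import Data.Nat using (ℕ; zero; suc; _+_; _*_; _^_)
open import Data.Nat.Properties using (_≟_)
open import Data.List using (List; filter; length; upTo; map; foldr)
open import Data.Integer using (ℤ; +_; _-_)
import Data.Integer as ℤ
open import Relation.Binary.PropositionalEquality using (_≡_)
open import Relation.Nullary using (Dec)
open import Data.Fin using (Fin; toℕ)
open import Data.Fin.Properties using (any?)
open import Data.Product using (∃)

-- Since p ≥ 2 and j ≥ 1 force p^k j ≥ 2^k > k, any witness k satisfies k < x,
-- so restricting the search to k < x (i.e. k : Fin x) loses nothing in the
-- situation of the lemma (p prime, j ≥ 1).
InOrbit : ℕ → ℕ → ℕ → Set
InOrbit p j x = ∃ λ (k : Fin x) → j * p ^ toℕ k ≡ x

inOrbit? : (p j x : ℕ) → Dec (InOrbit p j x)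
inOrbit? p j x = any? λ k → j * p ^ toℕ k ≟ x

s : ℕ → ℕ → ℕ → ℕ → ℕ
s p m i j = length (filter (inOrbit? p j) (map suc (upTo (m * suc i))))

sumℤ : List ℤ → ℤ
sumℤ = foldr ℤ._+_ (+ 0)

vα : ℕ → ℕ → ℕ → ℕ → ℕ → ℤ
vα p m n i j = sumℤ (map (λ h → + s p m h j - + s p n h j) (upTo i))

{-# OPTIONS --safe #-}
module Submission where

-- Write e_k = j p^k. Counting by k instead of by h, the sum
-- Σ_{h<i} (s_p(m,h,j) − s_p(n,h,j)) equals Σ_k w(e_k), where w(e) is the
-- number of h < i with n(h+1) < e ≤ m(h+1). Locating e between consecutive
-- multiples of n and of m gives (m − n) e ≤ mn·w(e) + mn whenever e ≤ n(i+1).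
-- The k with e_k ≤ n(i+1) are exactly the t = s_p(n,i,j) indices k < t, and
-- Σ_{k<t} e_k = j (p^t − 1)/(p − 1), so the hypothesis turns the summed local
-- bounds into Σ_{k<t} w(e_k) ≥ 2t − t = t.

open import Defs
open import Data.Nat using (ℕ; _*_; _^_; _∸_; _≤_; _<_)
open import Data.Nat.Divisibility using (_∣_)
open import Data.Nat.Primality using (Prime)
open import Data.Integer using (+_)
import Data.Integer as ℤ
open import Relation.Nullary using (¬_)

open import Data.Nat
  using (zero; suc; _+_; z≤n; s≤s; s≤s⁻¹; z<s; NonZero; nonTrivial⇒n>1; >-nonZero; >-nonZero⁻¹; _≤′_; ≤′-refl; ≤′-step; _≤?_; _<?_)
open import Data.Nat.Properties
open import Data.Nat.Primality using (prime⇒nonTrivial)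
open import Data.Nat.Tactic.RingSolver using (solve-∀)
import Data.Integer.Properties as ℤ
open import Data.List using (_∷_; filter; length; map; upTo; applyUpTo)
open import Data.List.Properties using (map-upTo)
open import Data.Fin using (toℕ; fromℕ<)
open import Data.Fin.Properties using (toℕ<n; toℕ-fromℕ<)
open import Data.Product using (_,_)
open import Data.Sum using (inj₁; inj₂; [_,_]′)
open import Function using (_∘_; id)
open import Relation.Binary.PropositionalEquality
open import Relation.Binary.Definitions using (tri<; tri≈; tri>)
open import Relation.Nullary using (Dec; yes; no; contradiction)
open import Relation.Unary using (Decidable; _⊆_)

∑< : ℕ → (ℕ → ℕ) → ℕ
∑< zero    f = 0
∑< (suc n) f = ∑< n f + f n

-- The body of ∑[ k < n ] binds tighter than any infix operator, so it is parenthesized.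
syntax ∑< n (λ k → e) = ∑[ k < n ] e

∑<-cong : ∀ n {f g} → (∀ k → k < n → f k ≡ g k) → ∑< n f ≡ ∑< n g
∑<-cong zero    f≡g = refl
∑<-cong (suc n) f≡g = cong₂ _+_ (∑<-cong n (λ k k<n → f≡g k (m<n⇒m<1+n k<n))) (f≡g n ≤-refl)

∑<-mono-≤ : ∀ n {f g} → (∀ k → k < n → f k ≤ g k) → ∑< n f ≤ ∑< n g
∑<-mono-≤ zero    f≤g = z≤n
∑<-mono-≤ (suc n) f≤g = +-mono-≤ (∑<-mono-≤ n (λ k k<n → f≤g k (m<n⇒m<1+n k<n))) (f≤g n ≤-refl)

∑<-monoˡ-≤ : ∀ f {n n′} → n ≤ n′ → ∑< n f ≤ ∑< n′ f
∑<-monoˡ-≤ f n≤n′ = go (≤⇒≤′ n≤n′)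
  where
  go : ∀ {n n′} → n ≤′ n′ → ∑< n f ≤ ∑< n′ f
  go ≤′-refl        = ≤-refl
  go (≤′-step n≤n′) = ≤-trans (go n≤n′) (m≤m+n _ _)

∑<-const : ∀ n c → ∑[ k < n ] c ≡ n * c
∑<-const zero    c = refl
∑<-const (suc n) c = trans (cong (_+ c) (∑<-const n c)) (+-comm (n * c) c)

∑<-zero : ∀ n {f} → (∀ k → k < n → f k ≡ 0) → ∑< n f ≡ 0
∑<-zero n f≡0 = trans (∑<-cong n f≡0) (trans (∑<-const n 0) (*-zeroʳ n))

∑<-unfoldˡ : ∀ n f → ∑< (suc n) f ≡ f 0 + ∑< n (f ∘ suc)
∑<-unfoldˡ zero    f = +-comm 0 (f 0)
∑<-unfoldˡ (suc n) f = trans (cong (_+ f (suc n)) (∑<-unfoldˡ n f)) (+-assoc (f 0) _ _)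

∑<-distrib-+ : ∀ n f g → ∑[ k < n ] (f k + g k) ≡ ∑< n f + ∑< n g
∑<-distrib-+ zero    f g = refl
∑<-distrib-+ (suc n) f g =
  trans (cong (_+ (f n + g n)) (∑<-distrib-+ n f g)) (interchange (∑< n f) (∑< n g) (f n) (g n))
  where
  interchange : ∀ a b c d → a + b + (c + d) ≡ a + c + (b + d)
  interchange = solve-∀

∑<-distrib-∸ : ∀ n f g → (∀ k → k < n → g k ≤ f k) → ∑[ k < n ] (f k ∸ g k) ≡ ∑< n f ∸ ∑< n g
∑<-distrib-∸ n f g g≤f = begin
    ∑[ k < n ] (f k ∸ g k)
  ≡⟨ m+n∸n≡m _ (∑< n g) ⟨
    ∑[ k < n ] (f k ∸ g k) + ∑< n g ∸ ∑< n g
  ≡⟨ cong (_∸ ∑< n g) (∑<-distrib-+ n (λ k → f k ∸ g k) g) ⟨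
    ∑[ k < n ] (f k ∸ g k + g k) ∸ ∑< n g
  ≡⟨ cong (_∸ ∑< n g) (∑<-cong n (λ k k<n → m∸n+n≡m (g≤f k k<n))) ⟩
    ∑< n f ∸ ∑< n g ∎
  where open ≡-Reasoning

*-distribˡ-∑< : ∀ n c f → c * ∑< n f ≡ ∑[ k < n ] (c * f k)
*-distribˡ-∑< zero    c f = *-zeroʳ c
*-distribˡ-∑< (suc n) c f = trans (*-distribˡ-+ c (∑< n f) (f n)) (cong (_+ c * f n) (*-distribˡ-∑< n c f))

∑<-comm : ∀ a b (g : ℕ → ℕ → ℕ) → ∑[ h < a ] ∑< b (g h) ≡ ∑[ k < b ] ∑[ h < a ] g h k
∑<-comm zero    b g = sym (∑<-zero b (λ _ _ → refl))
∑<-comm (suc a) b g =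
  trans (cong (_+ ∑< b (g a)) (∑<-comm a b g)) (sym (∑<-distrib-+ b (λ k → ∑[ h < a ] g h k) (g a)))

𝟙 : {A : Set} → Dec A → ℕ
𝟙 (yes _) = 1
𝟙 (no _)  = 0

𝟙-yes : {A : Set} (a? : Dec A) → A → 𝟙 a? ≡ 1
𝟙-yes (yes _) _ = refl
𝟙-yes (no ¬a) a = contradiction a ¬a

𝟙-no : {A : Set} (a? : Dec A) → ¬ A → 𝟙 a? ≡ 0
𝟙-no (yes a) ¬a = contradiction a ¬a
𝟙-no (no _)  _  = refl

𝟙≤1 : {A : Set} (a? : Dec A) → 𝟙 a? ≤ 1
𝟙≤1 (yes _) = ≤-refl
𝟙≤1 (no _)  = z≤n

𝟙-mono : {A B : Set} (a? : Dec A) (b? : Dec B) → (A → B) → 𝟙 a? ≤ 𝟙 b?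
𝟙-mono (yes a) b? f = ≤-reflexive (sym (𝟙-yes b? (f a)))
𝟙-mono (no _)  b? f = z≤n

𝟙-cong : {A B : Set} (a? : Dec A) (b? : Dec B) → (A → B) → (B → A) → 𝟙 a? ≡ 𝟙 b?
𝟙-cong a? b? f g = ≤-antisym (𝟙-mono a? b? f) (𝟙-mono b? a? g)

count : {P : ℕ → Set} → Decidable P → ℕ → ℕ
count P? n = ∑[ k < n ] 𝟙 (P? k)

count≤n : ∀ {P} (P? : Decidable P) n → count P? n ≤ n
count≤n P? n = begin
  count P? n     ≤⟨ ∑<-mono-≤ n (λ k _ → 𝟙≤1 (P? k)) ⟩
  ∑[ k < n ] 1   ≡⟨ ∑<-const n 1 ⟩
  n * 1          ≡⟨ *-identityʳ n ⟩
  n              ∎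
  where open ≤-Reasoning

count-mono : ∀ {P Q} (P? : Decidable P) (Q? : Decidable Q) n → P ⊆ Q → count P? n ≤ count Q? n
count-mono P? Q? n P⊆Q = ∑<-mono-≤ n (λ k _ → 𝟙-mono (P? k) (Q? k) P⊆Q)

count-∸ : ∀ {P Q} (P? : Decidable P) (Q? : Decidable Q) n → P ⊆ Q →
          count Q? n ∸ count P? n ≡ ∑[ k < n ] (𝟙 (Q? k) ∸ 𝟙 (P? k))
count-∸ P? Q? n P⊆Q = sym (∑<-distrib-∸ n _ _ (λ k _ → 𝟙-mono (P? k) (Q? k) P⊆Q))

count-all : ∀ {P} (P? : Decidable P) n → (∀ k → k < n → P k) → count P? n ≡ n
count-all P? n all = trans (∑<-cong n (λ k k<n → 𝟙-yes (P? k) (all k k<n))) (trans (∑<-const n 1) (*-identityʳ n))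

count-≟ : ∀ {k₀ n} → k₀ < n → count (_≟ k₀) n ≡ 1
count-≟ {k₀} {suc n} k₀<1+n with m≤n⇒m<n∨m≡n (s≤s⁻¹ k₀<1+n)
... | inj₁ k₀<n = cong₂ _+_ (count-≟ k₀<n) (𝟙-no (n ≟ k₀) (>⇒≢ k₀<n))
... | inj₂ refl = cong₂ _+_ (∑<-zero n (λ k k<n → 𝟙-no (k ≟ n) (<⇒≢ k<n))) (𝟙-yes (n ≟ n) refl)

length-filter-∷ : ∀ {A : Set} {P} (P? : Decidable P) (x : A) xs →
                  length (filter P? (x ∷ xs)) ≡ 𝟙 (P? x) + length (filter P? xs)
length-filter-∷ P? x xs with P? x
... | yes _ = refl
... | no _  = refl

length-filter-applyUpTo : ∀ {A : Set} {P} (P? : Decidable P) (f : ℕ → A) n →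
                          length (filter P? (applyUpTo f n)) ≡ count (P? ∘ f) n
length-filter-applyUpTo P? f zero    = refl
length-filter-applyUpTo P? f (suc n) = begin
    length (filter P? (applyUpTo f (suc n)))
  ≡⟨ length-filter-∷ P? (f 0) _ ⟩
    𝟙 (P? (f 0)) + length (filter P? (applyUpTo (f ∘ suc) n))
  ≡⟨ cong (_+_ (𝟙 (P? (f 0)))) (length-filter-applyUpTo P? (f ∘ suc) n) ⟩
    𝟙 (P? (f 0)) + count (P? ∘ f ∘ suc) n
  ≡⟨ ∑<-unfoldˡ n (𝟙 ∘ P? ∘ f) ⟨
    count (P? ∘ f) (suc n) ∎
  where open ≡-Reasoning

module DownClosedCount {P : ℕ → Set} (P? : Decidable P) (downClosed : ∀ {x y} → x ≤ y → P y → P x) where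

  count≤refuted : ∀ {x} n → ¬ P x → count P? n ≤ x
  count≤refuted     zero    _   = z≤n
  count≤refuted {x} (suc n) ¬Px with n <? x
  ... | yes n<x = ≤-trans (count≤n P? (suc n)) n<x
  ... | no  n≮x = begin
    count P? n + 𝟙 (P? n) ≡⟨ cong (_+_ (count P? n)) (𝟙-no (P? n) (¬Px ∘ downClosed (≮⇒≥ n≮x))) ⟩
    count P? n + 0        ≡⟨ +-identityʳ _ ⟩
    count P? n            ≤⟨ count≤refuted n ¬Px ⟩
    x                     ∎
    where open ≤-Reasoning

  below-count : ∀ {k} n → k < count P? n → P k
  below-count {k} n k<count with P? k
  ... | yes Pk  = Pk
  ... | no  ¬Pk = contradiction (count≤refuted n ¬Pk) (<⇒≱ k<count)

  ¬at-count : ∀ n → count P? n < n → ¬ P (count P? n)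
  ¬at-count n c<n Pc = <-irrefl refl (begin-strict
    c                  <⟨ n<1+n c ⟩
    suc c              ≡⟨ count-all P? (suc c) (λ k k<1+c → downClosed (s≤s⁻¹ k<1+c) Pc) ⟨
    count P? (suc c)   ≤⟨ ∑<-monoˡ-≤ (𝟙 ∘ P?) c<n ⟩
    c                  ∎)
    where
    open ≤-Reasoning
    c = count P? n

+-≡⇒∸-≡ : ∀ x x′ y y′ → x + x′ ≡ y + y′ → x ∸ y ≡ y′ ∸ x′
+-≡⇒∸-≡ zero    x′ y     y′ eq = trans (0∸n≡0 y) (sym (m≤n⇒m∸n≡0 (subst (y′ ≤_) (sym eq) (m≤n+m y′ y))))
+-≡⇒∸-≡ (suc x) x′ zero    y′ eq = sym (subst (λ z → z ∸ x′ ≡ suc x) eq (m+n∸n≡m (suc x) x′))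
+-≡⇒∸-≡ (suc x) x′ (suc y) y′ eq = +-≡⇒∸-≡ x x′ y y′ (suc-injective eq)

𝟙-≤+𝟙-> : ∀ e M → 𝟙 (e ≤? M) + 𝟙 (M <? e) ≡ 1
𝟙-≤+𝟙-> e M with e ≤? M
... | yes e≤M = cong suc (𝟙-no (M <? e) (≤⇒≯ e≤M))
... | no  e≰M = 𝟙-yes (M <? e) (≰⇒> e≰M)

𝟙-≤-suc : ∀ x N → 𝟙 (x ≤? suc N) ≡ 𝟙 (x ≤? N) + 𝟙 (x ≟ suc N)
𝟙-≤-suc x N with x ≤? N
... | yes x≤N = trans (𝟙-yes (x ≤? suc N) (m≤n⇒m≤1+n x≤N)) (sym (cong suc (𝟙-no (x ≟ suc N) (<⇒≢ (s≤s x≤N)))))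
... | no  x≰N = 𝟙-cong (x ≤? suc N) (x ≟ suc N)
  (λ x≤1+N → [ (λ x<1+N → contradiction (s≤s⁻¹ x<1+N) x≰N) , id ]′ (m≤n⇒m<n∨m≡n x≤1+N))
  (λ { refl → ≤-refl })

+m-+n≡+[m∸n] : ∀ {m n} → n ≤ m → + m ℤ.- + n ≡ + (m ∸ n)
+m-+n≡+[m∸n] {m} {n} n≤m = trans (ℤ.[+m]-[+n]≡m⊖n m n) (ℤ.⊖-≥ n≤m)

sumℤ-applyUpTo : ∀ n {g : ℕ → ℤ.ℤ} {F : ℕ → ℕ} → (∀ h → h < n → g h ≡ + F h) → sumℤ (applyUpTo g n) ≡ + ∑< n F
sumℤ-applyUpTo zero          _   = refl
sumℤ-applyUpTo (suc n) {g} {F} g≡F = begin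
    g 0 ℤ.+ sumℤ (applyUpTo (g ∘ suc) n)
  ≡⟨ cong₂ ℤ._+_ (g≡F 0 z<s) (sumℤ-applyUpTo n (λ h h<n → g≡F (suc h) (s≤s h<n))) ⟩
    + F 0 ℤ.+ + ∑< n (F ∘ suc)
  ≡⟨ ℤ.pos-+ (F 0) _ ⟨
    + (F 0 + ∑< n (F ∘ suc))
  ≡⟨ cong +_ (∑<-unfoldˡ n F) ⟨
    + ∑< (suc n) F ∎
  where open ≡-Reasoning

multiplesBelow : ℕ → ℕ → ℕ → ℕ
multiplesBelow q i e = count (λ h → q * suc h <? e) i

module MultiplesBelow (q i e : ℕ) where
  open DownClosedCount (λ h → q * suc h <? e) (λ x≤y → ≤-<-trans (*-monoʳ-≤ q (s≤s x≤y)))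

  *-multiplesBelow≤ : q * multiplesBelow q i e ≤ e
  *-multiplesBelow≤ with multiplesBelow q i e in eq
  ... | zero  = subst (_≤ e) (sym (*-zeroʳ q)) z≤n
  ... | suc b = <⇒≤ (below-count i (subst (b <_) (sym eq) ≤-refl))

  ≤-*-suc-multiplesBelow : e ≤ q * suc i → e ≤ q * suc (multiplesBelow q i e)
  ≤-*-suc-multiplesBelow e≤q[1+i] with m≤n⇒m<n∨m≡n (count≤n _ i)
  ... | inj₁ a<i = ≮⇒≥ (¬at-count i a<i)
  ... | inj₂ a≡i = subst (λ a → e ≤ q * suc a) (sym a≡i) e≤q[1+i]

open MultiplesBelow

multiplesBelow-antitone : ∀ {m n} i e → n ≤ m → multiplesBelow m i e ≤ multiplesBelow n i e
multiplesBelow-antitone i e n≤m = count-mono _ _ i (λ {h} → ≤-<-trans (*-monoˡ-≤ (suc h) n≤m))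

-- The number of h < i with n (h + 1) < e ≤ m (h + 1) (for n ≤ m).
window : ℕ → ℕ → ℕ → ℕ → ℕ
window m n i e = multiplesBelow n i e ∸ multiplesBelow m i e

gap-bound : ∀ {m n a b e} → n ≤ m → b ≤ a → m * b ≤ e → e ≤ n * suc a →
            (m ∸ n) * e ≤ m * n * (a ∸ b) + m * n
gap-bound {m} {n} {a} {b} {e} n≤m b≤a mb≤e e≤n[1+a] = +-cancelʳ-≤ _ _ _ (begin
    (m ∸ n) * e + n * (m * b)    ≤⟨ +-monoʳ-≤ ((m ∸ n) * e) (*-monoʳ-≤ n mb≤e) ⟩
    (m ∸ n) * e + n * e          ≡⟨ *-distribʳ-+ e (m ∸ n) n ⟨
    (m ∸ n + n) * e              ≡⟨ cong (_* e) (m∸n+n≡m n≤m) ⟩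
    m * e                        ≤⟨ *-monoʳ-≤ m e≤n[1+a] ⟩
    m * (n * suc a)              ≡⟨ cong (λ a → m * (n * suc a)) (m∸n+n≡m b≤a) ⟨
    m * (n * suc (a ∸ b + b))    ≡⟨ expand m n (a ∸ b) b ⟩
    m * n * (a ∸ b) + m * n + n * (m * b) ∎)
  where
  open ≤-Reasoning
  expand : ∀ m n c b → m * (n * suc (c + b)) ≡ m * n * c + m * n + n * (m * b)
  expand = solve-∀

window-bound : ∀ {m n} i e → n ≤ m → e ≤ n * suc i → (m ∸ n) * e ≤ m * n * window m n i e + m * n
window-bound {m} {n} i e n≤m e≤n[1+i] =
  gap-bound n≤m (multiplesBelow-antitone i e n≤m) (*-multiplesBelow≤ m i e) (≤-*-suc-multiplesBelow n i e e≤n[1+i])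

𝟙-≤-∸-flip : ∀ e M N → 𝟙 (e ≤? M) ∸ 𝟙 (e ≤? N) ≡ 𝟙 (N <? e) ∸ 𝟙 (M <? e)
𝟙-≤-∸-flip e M N =
  +-≡⇒∸-≡ (𝟙 (e ≤? M)) (𝟙 (M <? e)) (𝟙 (e ≤? N)) (𝟙 (N <? e)) (trans (𝟙-≤+𝟙-> e M) (sym (𝟙-≤+𝟙-> e N)))

window-as-∑ : ∀ {m n} i e → n ≤ m → window m n i e ≡ ∑[ h < i ] (𝟙 (e ≤? m * suc h) ∸ 𝟙 (e ≤? n * suc h))
window-as-∑ {m} {n} i e n≤m = begin
    window m n i e
  ≡⟨ count-∸ (λ h → m * suc h <? e) (λ h → n * suc h <? e) i (λ {h} → ≤-<-trans (*-monoˡ-≤ (suc h) n≤m)) ⟩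
    ∑[ h < i ] (𝟙 (n * suc h <? e) ∸ 𝟙 (m * suc h <? e))
  ≡⟨ ∑<-cong i (λ h _ → 𝟙-≤-∸-flip e (m * suc h) (n * suc h)) ⟨
    ∑[ h < i ] (𝟙 (e ≤? m * suc h) ∸ 𝟙 (e ≤? n * suc h)) ∎
  where open ≡-Reasoning

∑-window : ∀ {m n} i (f : ℕ → ℕ) B → n ≤ m →
           ∑[ h < i ] (count (λ k → f k ≤? m * suc h) B ∸ count (λ k → f k ≤? n * suc h) B)
           ≡ ∑[ k < B ] window m n i (f k)
∑-window {m} {n} i f B n≤m = begin
    ∑[ h < i ] (count (λ k → f k ≤? m * suc h) B ∸ count (λ k → f k ≤? n * suc h) B)
  ≡⟨ ∑<-cong i (λ h _ → count-∸ _ _ B (λ {k} fk≤n[1+h] → ≤-trans fk≤n[1+h] (*-monoˡ-≤ (suc h) n≤m))) ⟩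
    ∑[ h < i ] ∑[ k < B ] (𝟙 (f k ≤? m * suc h) ∸ 𝟙 (f k ≤? n * suc h))
  ≡⟨ ∑<-comm i B (λ h k → 𝟙 (f k ≤? m * suc h) ∸ 𝟙 (f k ≤? n * suc h)) ⟩
    ∑[ k < B ] ∑[ h < i ] (𝟙 (f k ≤? m * suc h) ∸ 𝟙 (f k ≤? n * suc h))
  ≡⟨ ∑<-cong B (λ k _ → window-as-∑ i (f k) n≤m) ⟨
    ∑[ k < B ] window m n i (f k) ∎
  where open ≡-Reasoning

geometric-sum : ∀ p .{{_ : NonZero p}} T → (p ∸ 1) * ∑[ k < T ] (p ^ k) + 1 ≡ p ^ T
geometric-sum (suc q) zero    = cong (_+ 1) (*-zeroʳ q)
geometric-sum (suc q) (suc T) =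
  trans (regroup q (∑[ k < T ] (suc q ^ k)) (suc q ^ T)) (cong (_+ q * suc q ^ T) (geometric-sum (suc q) T))
  where
  regroup : ∀ q G y → q * (G + y) + 1 ≡ q * G + 1 + q * y
  regroup = solve-∀

module Orbit (p j : ℕ) .{{_ : NonZero j}} (1<p : 1 < p) where

  private instance
    p≢0 : NonZero p
    p≢0 = >-nonZero (<-trans z<s 1<p)

  orbit : ℕ → ℕ
  orbit k = j * p ^ k

  orbit-strictMono : ∀ {x y} → x < y → orbit x < orbit y
  orbit-strictMono x<y = *-monoʳ-< j (^-monoʳ-< p 1<p x<y)

  orbit-mono : ∀ {x y} → x ≤ y → orbit x ≤ orbit y
  orbit-mono x≤y = *-monoʳ-≤ j (^-monoʳ-≤ p x≤y)

  orbit-injective : ∀ {x y} → orbit x ≡ orbit y → x ≡ y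
  orbit-injective {x} {y} eq with <-cmp x y
  ... | tri< x<y _ _ = contradiction eq (<⇒≢ (orbit-strictMono x<y))
  ... | tri≈ _ x≡y _ = x≡y
  ... | tri> _ _ y<x = contradiction eq (>⇒≢ (orbit-strictMono y<x))

  k<orbit : ∀ k → k < orbit k
  k<orbit zero    = subst (0 <_) (sym (*-identityʳ j)) (>-nonZero⁻¹ j)
  k<orbit (suc k) = ≤-<-trans (k<orbit k) (orbit-strictMono (n<1+n k))

  orbitCount : ℕ → ℕ
  orbitCount N = length (filter (inOrbit? p j) (map suc (upTo N)))

  𝟙-inOrbit : ∀ {y B} → y ≤ B → 𝟙 (inOrbit? p j y) ≡ count (λ k → orbit k ≟ y) B
  𝟙-inOrbit {y} {B} y≤B with inOrbit? p j y
  ... | yes (k , orbit-k≡y) = sym (trans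
          (∑<-cong B (λ k′ _ → 𝟙-cong (orbit k′ ≟ y) (k′ ≟ toℕ k)
                                  (λ eq → orbit-injective (trans eq (sym orbit-k≡y))) (λ { refl → orbit-k≡y })))
          (count-≟ (<-≤-trans (toℕ<n k) y≤B)))
  ... | no ¬inOrbit = sym (∑<-zero B (λ k _ → 𝟙-no (orbit k ≟ y) (¬inOrbit ∘ witness k)))
    where
    witness : ∀ k → orbit k ≡ y → InOrbit p j y
    witness k eq = fromℕ< k<y , trans (cong orbit (toℕ-fromℕ< k<y)) eq
      where k<y = subst (k <_) eq (k<orbit k)

  count-inOrbit : ∀ {N B} → N ≤ B → count (inOrbit? p j ∘ suc) N ≡ count (λ k → orbit k ≤? N) B
  count-inOrbit {zero}  {B} _ =
    sym (∑<-zero B (λ k _ → 𝟙-no (orbit k ≤? 0) (<⇒≱ (≤-<-trans z≤n (k<orbit k)))))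
  count-inOrbit {suc N} {B} 1+N≤B = begin
      count (inOrbit? p j ∘ suc) N + 𝟙 (inOrbit? p j (suc N))
    ≡⟨ cong₂ _+_ (count-inOrbit (≤-trans (n≤1+n N) 1+N≤B)) (𝟙-inOrbit 1+N≤B) ⟩
      count (λ k → orbit k ≤? N) B + count (λ k → orbit k ≟ suc N) B
    ≡⟨ ∑<-distrib-+ B _ _ ⟨
      ∑[ k < B ] (𝟙 (orbit k ≤? N) + 𝟙 (orbit k ≟ suc N))
    ≡⟨ ∑<-cong B (λ k _ → 𝟙-≤-suc (orbit k) N) ⟨
      count (λ k → orbit k ≤? suc N) B ∎
    where open ≡-Reasoning

  orbitCount≡count : ∀ N {B} → N ≤ B → orbitCount N ≡ count (λ k → orbit k ≤? N) B
  orbitCount≡count N N≤B =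
    trans (cong (length ∘ filter (inOrbit? p j)) (map-upTo suc N))
          (trans (length-filter-applyUpTo (inOrbit? p j) suc N) (count-inOrbit N≤B))

  orbitCount-mono : ∀ {N M} → N ≤ M → orbitCount N ≤ orbitCount M
  orbitCount-mono {N} {M} N≤M =
    subst₂ _≤_ (sym (orbitCount≡count N N≤M)) (sym (orbitCount≡count M ≤-refl))
           (count-mono _ _ M (λ orbit≤N → ≤-trans orbit≤N N≤M))

  below-orbitCount : ∀ {k N} → k < orbitCount N → orbit k ≤ N
  below-orbitCount {k} {N} k<count =
    below-count N (subst (k <_) (orbitCount≡count N ≤-refl) k<count)
    where open DownClosedCount (λ k → orbit k ≤? N) (λ x≤y → ≤-trans (orbit-mono x≤y))

  orbitCount≤ : ∀ N → orbitCount N ≤ N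
  orbitCount≤ N = subst (_≤ N) (sym (orbitCount≡count N ≤-refl)) (count≤n _ N)

  vα≡∑window : ∀ {m n} i → n ≤ m → vα p m n i j ≡ + ∑[ k < m * suc i ] window m n i (orbit k)
  vα≡∑window {m} {n} i n≤m = begin
      vα p m n i j
    ≡⟨ cong sumℤ (map-upTo _ i) ⟩
      sumℤ (applyUpTo (λ h → + orbitCount (m * suc h) ℤ.- + orbitCount (n * suc h)) i)
    ≡⟨ sumℤ-applyUpTo i (λ h _ → +m-+n≡+[m∸n] (orbitCount-mono (*-monoˡ-≤ (suc h) n≤m))) ⟩
      + ∑[ h < i ] (orbitCount (m * suc h) ∸ orbitCount (n * suc h))
    ≡⟨ cong +_ (∑<-cong i (λ h h<i → cong₂ _∸_ (orbitCount≡count (m * suc h) (m[1+h]≤B h<i))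
                                              (orbitCount≡count (n * suc h) (≤-trans (*-monoˡ-≤ (suc h) n≤m) (m[1+h]≤B h<i))))) ⟩
      + ∑[ h < i ] (count (λ k → orbit k ≤? m * suc h) B ∸ count (λ k → orbit k ≤? n * suc h) B)
    ≡⟨ cong +_ (∑-window i orbit B n≤m) ⟩
      + ∑[ k < B ] window m n i (orbit k) ∎
    where
    open ≡-Reasoning
    B = m * suc i
    m[1+h]≤B : ∀ {h} → h < i → m * suc h ≤ B
    m[1+h]≤B h<i = *-monoʳ-≤ m (<⇒≤ (s≤s h<i))

  ∑-orbit : ∀ T → (p ∸ 1) * ∑[ k < T ] orbit k ≡ (p ^ T ∸ 1) * j
  ∑-orbit T = begin
      (p ∸ 1) * ∑[ k < T ] orbit k
    ≡⟨ cong ((p ∸ 1) *_) (*-distribˡ-∑< T j (p ^_)) ⟨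
      (p ∸ 1) * (j * G)
    ≡⟨ cong ((p ∸ 1) *_) (*-comm j G) ⟩
      (p ∸ 1) * (G * j)
    ≡⟨ *-assoc (p ∸ 1) G j ⟨
      (p ∸ 1) * G * j
    ≡⟨ cong (_* j) (m+n∸n≡m ((p ∸ 1) * G) 1) ⟨
      ((p ∸ 1) * G + 1 ∸ 1) * j
    ≡⟨ cong (λ x → (x ∸ 1) * j) (geometric-sum p T) ⟩
      (p ^ T ∸ 1) * j ∎
    where
    open ≡-Reasoning
    G = ∑[ k < T ] (p ^ k)

  window-sum-bound : ∀ {m n} i T .{{_ : NonZero m}} .{{_ : NonZero n}} → n ≤ m →
                     (∀ k → k < T → orbit k ≤ n * suc i) →
                     2 * T * (m * n * (p ∸ 1)) ≤ (m ∸ n) * (p ^ T ∸ 1) * j →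
                     T ≤ ∑[ k < T ] window m n i (orbit k)
  window-sum-bound {m} {n} i T n≤m bounded hyp = +-cancelʳ-≤ T T W (*-cancelˡ-≤ K (begin
      K * (T + T)                                  ≡⟨ double K T ⟩
      2 * T * K                                    ≤⟨ hyp ⟩
      (m ∸ n) * (p ^ T ∸ 1) * j                    ≡⟨ *-assoc (m ∸ n) _ j ⟩
      (m ∸ n) * ((p ^ T ∸ 1) * j)                  ≡⟨ cong ((m ∸ n) *_) (∑-orbit T) ⟨
      (m ∸ n) * ((p ∸ 1) * ∑[ k < T ] orbit k)     ≡⟨ left-comm (m ∸ n) (p ∸ 1) _ ⟩
      (p ∸ 1) * ((m ∸ n) * ∑[ k < T ] orbit k)     ≡⟨ cong ((p ∸ 1) *_) (*-distribˡ-∑< T (m ∸ n) orbit) ⟩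
      (p ∸ 1) * ∑[ k < T ] ((m ∸ n) * orbit k)     ≤⟨ *-monoʳ-≤ (p ∸ 1) (∑<-mono-≤ T local) ⟩
      (p ∸ 1) * ∑[ k < T ] (m * n * w k + m * n)   ≡⟨ cong ((p ∸ 1) *_) summed ⟩
      (p ∸ 1) * (m * n * W + T * (m * n))          ≡⟨ collect (p ∸ 1) (m * n) W T ⟩
      K * (W + T)                                  ∎))
    where
    open ≤-Reasoning
    w : ℕ → ℕ
    w k = window m n i (orbit k)
    W K : ℕ
    W = ∑< T w
    K = m * n * (p ∸ 1)
    instance
      K≢0 : NonZero K
      K≢0 = m*n≢0 (m * n) (p ∸ 1) {{m*n≢0 m n}} {{>-nonZero (m<n⇒0<n∸m 1<p)}}
    local : ∀ k → k < T → (m ∸ n) * orbit k ≤ m * n * w k + m * n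
    local k k<T = window-bound i (orbit k) n≤m (bounded k k<T)
    summed : ∑[ k < T ] (m * n * w k + m * n) ≡ m * n * W + T * (m * n)
    summed = trans (∑<-distrib-+ T _ _) (cong₂ _+_ (sym (*-distribˡ-∑< T (m * n) w)) (∑<-const T (m * n)))
    double : ∀ K T → K * (T + T) ≡ 2 * T * K
    double = solve-∀
    left-comm : ∀ a b c → a * (b * c) ≡ b * (a * c)
    left-comm = solve-∀
    collect : ∀ r k W T → r * (k * W + T * k) ≡ k * r * (W + T)
    collect = solve-∀

lemma6p1 : (p m n i j : ℕ) → Prime p → 1 ≤ n → n < m → 1 ≤ j → ¬ (p ∣ j)
    → 2 * s p n i j * (m * n * (p ∸ 1)) ≤ (m ∸ n) * (p ^ s p n i j ∸ 1) * j
    → + s p n i j ℤ.≤ vα p m n i j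
lemma6p1 p m n i j p-prime 1≤n n<m 1≤j _ hyp =
  subst (+ t ℤ.≤_) (sym (vα≡∑window i n≤m)) (ℤ.+≤+ (begin
    t                                          ≤⟨ window-sum-bound i t n≤m (λ _ → below-orbitCount) hyp ⟩
    ∑[ k < t ] window m n i (orbit k)          ≤⟨ ∑<-monoˡ-≤ _ t≤m[1+i] ⟩
    ∑[ k < m * suc i ] window m n i (orbit k)  ∎))
  where
  open Orbit p j {{>-nonZero 1≤j}} (nonTrivial⇒n>1 p {{prime⇒nonTrivial p-prime}})
  open ≤-Reasoning
  instance
    n≢0 : NonZero n
    n≢0 = >-nonZero 1≤n
    m≢0 : NonZero m
    m≢0 = >-nonZero (<-trans 1≤n n<m)
  n≤m : n ≤ m
  n≤m = <⇒≤ n<m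
  t : ℕ
  t = s p n i j
  t≤m[1+i] : t ≤ m * suc i
  t≤m[1+i] = ≤-trans (orbitCount≤ (n * suc i)) (*-monoˡ-≤ (suc i) n≤m)
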